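{- Let $k,\ell$ be positive odd integers with $\ell>k$, and let $n\ge 2$ be an integer. If $n < p^3$ for every prime $p \mid n$, then $a_{k,\ell}(n) < 0$.
   Context: For positive integers $n$, define \[ a_{k,\ell}(n) := (n^{3\ell} + n^{2\ell} + n^{\ell} + 1)\,\sigma_{3k}(n) - (n^{3k} + n^{2k} + n^{k} + 1)\,\sigma_{3\ell}(n), \] where $\sigma_s(n)=\sum_{d\mid n}d^s$. -}

module Defs where

open import Data.Nat using (ℕ; suc; _^_; _+_)
open import Data.Nat.Divisibility using (_∣?_)
open import Data.List using (List; filter; map; upTo)
open import Data.Nat.ListAction using (sum)
open import Data.Integer using (ℤ; +_; _-_; _*_)

divisors : ℕ → List ℕ
divisors n = filter (_∣? n) (map suc (upTo n))

σ : ℕ → ℕ → ℕ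
σ s n = sum (map (λ d → d ^ s) (divisors n))

a : ℕ → ℕ → ℕ → ℤ
a k ℓ n = (+ (n ^ (3 Data.Nat.* ℓ) + n ^ (2 Data.Nat.* ℓ) + n ^ ℓ + 1)) * (+ σ (3 Data.Nat.* k) n)
        - (+ (n ^ (3 Data.Nat.* k) + n ^ (2 Data.Nat.* k) + n ^ k + 1)) * (+ σ (3 Data.Nat.* ℓ) n)

-- Under the hypothesis, n is p, p² or pq with p < q < p². For m = n^k the proper divisors
-- contribute some S to σ_{3k}(n) ≤ 1 + m³ + S with n²S + m² ≤ n²m²; for n = pq this reduces
-- to p³ + q³ + 1 ≤ p²q², which is where q < p² is needed. Hence σ_{3k}(n) falls short of
-- geometric₃ m = m³ + m² + m + 1 by some E with geometric₃ m ≤ n²mE. As k and ℓ are odd,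
-- ℓ ≥ k + 2, so M = n^ℓ ≥ n²m; together with σ_{3ℓ}(n) ≥ 1 + M³ this yields
-- geometric₃ M · σ_{3k}(n) < geometric₃ m · σ_{3ℓ}(n), which is a_{k,ℓ}(n) < 0.

module Submission where

open import Defs
open import Data.Nat using (ℕ; _<_; _≤_; _^_)
open import Data.Nat.Divisibility using (_∣_)
open import Data.Nat.Primality using (Prime)
open import Data.Integer using (0ℤ) renaming (_<_ to _<ℤ_)
open import Relation.Nullary using (¬_)

open import Data.Nat
  using (zero; suc; _+_; _*_; _∸_; z≤n; s≤s; z<s; NonZero; >-nonZero; >-nonZero⁻¹; ≢-nonZero⁻¹; nonTrivial⇒n>1)
open import Data.Nat.Properties
open import Data.Nat.Divisibility
  using (divides; _∣?_; ∣⇒≤; 0∣⇒≡0; 1∣_; ∣-refl; m∣m*n; n∣m*n; ∣-trans; *-cancelˡ-∣)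
open import Data.Nat.Primality
  using (prime⇒irreducible; prime⇒nonZero; prime⇒nonTrivial; productOfPrimes≥1)
open import Data.Nat.Primality.Factorisation using (factorise; PrimeFactorisation)
open import Data.Nat.Coprimality using (Coprime; coprime-divisor)
open import Data.Nat.ListAction using (sum; product)
open import Data.Nat.ListAction.Properties using (sum-↭)
open import Data.Nat.Tactic.RingSolver using (solve-∀)
open import Data.Integer as ℤ using (+_)
open import Data.Integer.Properties using (m-n≡m⊖n; ⊖-monoˡ-<; n⊖n≡0; pos-*)
open import Data.List using (List; []; _∷_; _++_; [_]; map; upTo)
open import Data.List.Membership.Propositional using (_∈_)
open import Data.List.Membership.Propositional.Properties
  using (∈-∃++; ∈-++⁻; ∈-++⁺ˡ; ∈-++⁺ʳ; ∈-filter⁺; ∈-filter⁻; ∈-map⁺; ∈-upTo⁺)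
open import Data.List.Relation.Binary.Subset.Propositional using (_⊆_)
open import Data.List.Relation.Binary.Permutation.Propositional.Properties
  using (shift) renaming (map⁺ to ↭-map⁺)
open import Data.List.Relation.Unary.All as All using (All; []; _∷_)
open import Data.List.Relation.Unary.AllPairs using ([]; _∷_)
open import Data.List.Relation.Unary.Any using (here; there)
open import Data.List.Relation.Unary.Unique.Propositional using (Unique)
open import Data.List.Relation.Unary.Unique.Propositional.Properties
  using (upTo⁺) renaming (map⁺ to Unique-map⁺; filter⁺ to Unique-filter⁺)
open import Data.Product using (∃-syntax; _×_; _,_; proj₂)
open import Data.Sum using (_⊎_; inj₁; inj₂; [_,_]′)
open import Function using (_∘_)
open import Relation.Binary.Definitions using (tri<; tri≈; tri>)
open import Relation.Binary.PropositionalEquality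
  using (_≡_; refl; sym; trans; cong; cong₂; subst; subst₂)
open import Relation.Nullary using (yes; no; contradiction)

private
  variable
    c d e k m n p q r x y M S σ₁ σ₂ : ℕ

^-distribʳ-* : ∀ m n k → (m * n) ^ k ≡ m ^ k * n ^ k
^-distribʳ-* m n zero    = refl
^-distribʳ-* m n (suc k) = trans (cong (m * n *_) (^-distribʳ-* m n k)) (interchange m n (m ^ k) (n ^ k))
  where
  interchange : ∀ a b c d → a * b * (c * d) ≡ a * c * (b * d)
  interchange = solve-∀

^-*-comm : ∀ n c k → n ^ (c * k) ≡ (n ^ k) ^ c
^-*-comm n c k = trans (cong (n ^_) (*-comm c k)) (sym (^-*-assoc n k c))

^-square : ∀ n k → n ^ (2 * k) ≡ n ^ k * n ^ k
^-square n k = trans (^-*-comm n 2 k) (cong (n ^ k *_) (*-identityʳ (n ^ k)))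

^-cube : ∀ n k → n ^ (3 * k) ≡ n ^ k * n ^ k * n ^ k
^-cube n k = trans (^-*-comm n 3 k) (cube (n ^ k))
  where
  cube : ∀ x → x * (x * (x * 1)) ≡ x * x * x
  cube = solve-∀

m≤m^n : ∀ m {n} → .{{NonZero m}} → 1 ≤ n → m ≤ m ^ n
m≤m^n m {suc n} _ = m≤m*n m (m ^ n) {{m^n≢0 m n}}

m+n≤m*n : 2 ≤ m → 2 ≤ n → m + n ≤ m * n
m+n≤m*n {suc (suc u)} {suc (suc v)} (s≤s (s≤s z≤n)) (s≤s (s≤s z≤n)) =
  subst (2 + u + (2 + v) ≤_) (expand u v) (m≤m+n (2 + u + (2 + v)) (u + v + u * v))
  where
  expand : ∀ u v → 2 + u + (2 + v) + (u + v + u * v) ≡ (2 + u) * (2 + v)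
  expand = solve-∀

sum-map-mono-⊆ : {A : Set} (f : A → ℕ) {xs ys : List A} →
                 Unique xs → xs ⊆ ys → sum (map f xs) ≤ sum (map f ys)
sum-map-mono-⊆ f {[]} _ _ = z≤n
sum-map-mono-⊆ f {x ∷ xs} (x∉xs ∷ xs-unique) x∷xs⊆ys
  with us , vs , refl ← ∈-∃++ (x∷xs⊆ys (here refl)) = begin
    f x + sum (map f xs)         ≤⟨ +-monoʳ-≤ (f x) (sum-map-mono-⊆ f xs-unique xs⊆us++vs) ⟩
    f x + sum (map f (us ++ vs)) ≡⟨ sum-↭ (↭-map⁺ f (shift x us vs)) ⟨
    sum (map f (us ++ [ x ] ++ vs)) ∎
  where
  open ≤-Reasoning
  xs⊆us++vs : xs ⊆ us ++ vs
  xs⊆us++vs y∈xs with ∈-++⁻ us (x∷xs⊆ys (there y∈xs))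
  ... | inj₁ y∈us          = ∈-++⁺ˡ y∈us
  ... | inj₂ (here refl)   = contradiction refl (All.lookup x∉xs y∈xs)
  ... | inj₂ (there y∈vs)  = ∈-++⁺ʳ us y∈vs

∈-divisors : .{{NonZero n}} → d ∣ n → d ∈ divisors n
∈-divisors {n} {zero}  0∣n = contradiction (0∣⇒≡0 0∣n) (≢-nonZero⁻¹ n)
∈-divisors {n} {suc d} d∣n = ∈-filter⁺ (_∣? n) (∈-map⁺ suc (∈-upTo⁺ (∣⇒≤ d∣n))) d∣n

divisors-unique : ∀ n → Unique (divisors n)
divisors-unique n = Unique-filter⁺ (_∣? n) (Unique-map⁺ suc-injective (upTo⁺ n))

σ-lower : ∀ s → 2 ≤ n → 1 + n ^ s ≤ σ s n
σ-lower {n} s 2≤n = begin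
  1 + n ^ s           ≡⟨ cong₂ _+_ (^-zeroˡ s) (+-identityʳ (n ^ s)) ⟨
  1 ^ s + (n ^ s + 0) ≤⟨ sum-map-mono-⊆ (_^ s) ((<⇒≢ 2≤n ∷ []) ∷ [] ∷ []) 1∷n⊆divisors ⟩
  σ s n               ∎
  where
  open ≤-Reasoning
  instance _ = >-nonZero (<-trans z<s 2≤n)
  1∷n⊆divisors : 1 ∷ n ∷ [] ⊆ divisors n
  1∷n⊆divisors (here refl)         = ∈-divisors (1∣ n)
  1∷n⊆divisors (there (here refl)) = ∈-divisors ∣-refl

σ-upper : ∀ s (ds : List ℕ) → (∀ {d} → d ∣ n → d ∈ 1 ∷ n ∷ ds) →
          σ s n ≤ 1 + n ^ s + sum (map (_^ s) ds)
σ-upper {n} s ds divisor∈ = begin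
  σ s n                                 ≤⟨ sum-map-mono-⊆ (_^ s) (divisors-unique n) (divisor∈ ∘ ∣n) ⟩
  1 ^ s + (n ^ s + sum (map (_^ s) ds)) ≡⟨ cong (_+ (n ^ s + sum (map (_^ s) ds))) (^-zeroˡ s) ⟩
  1 + (n ^ s + sum (map (_^ s) ds))     ≡⟨ +-assoc 1 (n ^ s) _ ⟨
  1 + n ^ s + sum (map (_^ s) ds)       ∎
  where
  open ≤-Reasoning
  ∣n : ∀ {d} → d ∈ divisors n → d ∣ n
  ∣n d∈divisors = proj₂ (∈-filter⁻ (_∣? n) {xs = map suc (upTo n)} d∈divisors)

prime⇒2≤ : Prime p → 2 ≤ p
prime⇒2≤ p-prime = nonTrivial⇒n>1 _ {{prime⇒nonTrivial p-prime}}

SmallerThanPrimeCubes : ℕ → Set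
SmallerThanPrimeCubes n = ∀ p → Prime p → p ∣ n → n < p ^ 3

data Shape : ℕ → Set where
  prime       : Prime p → Shape p
  primeSquare : Prime p → Shape (p * p)
  semiprime   : Prime p → Prime q → p < q → q < p * p → Shape (p * q)

semiprime-shape : Prime p → Prime q → p < q → SmallerThanPrimeCubes (p * q) → Shape (p * q)
semiprime-shape {p} {q} p-prime q-prime p<q small =
  semiprime p-prime q-prime p<q (*-cancelˡ-< p q (p * p) p*q<p*[p*p])
  where
  p*q<p*[p*p] : p * q < p * (p * p)
  p*q<p*[p*p] = subst (λ t → p * q < p * (p * t)) (*-identityʳ p) (small p p-prime (m∣m*n q))

two-primes-shape : Prime p → Prime q → SmallerThanPrimeCubes (p * q) → Shape (p * q)
two-primes-shape {p} {q} p-prime q-prime small with <-cmp p q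
... | tri< p<q _ _ = semiprime-shape p-prime q-prime p<q small
... | tri≈ _ refl _ = primeSquare p-prime
... | tri> _ _ q<p = subst Shape (*-comm q p)
                       (semiprime-shape q-prime p-prime q<p (subst SmallerThanPrimeCubes (*-comm p q) small))

-- Multiplying the three bounds N < p³, N < q³, N < r³ gives N³ < (pqr)³ ≤ N³.
¬three-prime-factors : Prime p → Prime q → Prime r → 1 ≤ m →
                       ¬ SmallerThanPrimeCubes (p * (q * (r * m)))
¬three-prime-factors {p} {q} {r} {m} p-prime q-prime r-prime 1≤m small =
  <-irrefl refl (begin-strict
    N * N * N                                     <⟨ *-mono-< (*-mono-< N<p³ N<q³) N<r³ ⟩
    p ^ 3 * q ^ 3 * r ^ 3                         ≡⟨ cubes p q r ⟩
    (p * (q * r)) * (p * (q * r)) * (p * (q * r)) ≤⟨ *-mono-≤ (*-mono-≤ pqr≤N pqr≤N) pqr≤N ⟩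
    N * N * N                                     ∎)
  where
  open ≤-Reasoning
  N = p * (q * (r * m))
  N<p³ = small p p-prime (m∣m*n (q * (r * m)))
  N<q³ = small q q-prime (∣-trans (m∣m*n (r * m)) (n∣m*n p))
  N<r³ = small r r-prime (∣-trans (m∣m*n m) (∣-trans (n∣m*n q) (n∣m*n p)))
  pqr≤N : p * (q * r) ≤ N
  pqr≤N = subst (_≤ N) (cong (λ t → p * (q * t)) (*-identityʳ r))
                (*-monoʳ-≤ p (*-monoʳ-≤ q (*-monoʳ-≤ r 1≤m)))
  cubes : ∀ p q r → p * (p * (p * 1)) * (q * (q * (q * 1))) * (r * (r * (r * 1)))
                    ≡ (p * (q * r)) * (p * (q * r)) * (p * (q * r))
  cubes = solve-∀

shape : 2 ≤ n → SmallerThanPrimeCubes n → Shape n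
shape {n} 2≤n small =
  subst Shape (sym n≡∏) (shape-of-product (factors F) (factorsPrime F)
                           (subst (2 ≤_) n≡∏ 2≤n) (subst SmallerThanPrimeCubes n≡∏ small))
  where
  instance _ = >-nonZero (<-trans z<s 2≤n)
  open PrimeFactorisation
  F = factorise n
  n≡∏ = isFactorisation F
  shape-of-product : ∀ ps → All Prime ps → 2 ≤ product ps → SmallerThanPrimeCubes (product ps) →
                     Shape (product ps)
  shape-of-product [] _ (s≤s ()) _
  shape-of-product (p ∷ []) (p-prime ∷ []) _ _ = subst Shape (sym (*-identityʳ p)) (prime p-prime)
  shape-of-product (p ∷ q ∷ []) (p-prime ∷ q-prime ∷ []) _ small′ =
    subst Shape p*q≡ (two-primes-shape p-prime q-prime (subst SmallerThanPrimeCubes (sym p*q≡) small′))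
    where p*q≡ = cong (p *_) (sym (*-identityʳ q))
  shape-of-product (p ∷ q ∷ r ∷ rs) (p-prime ∷ q-prime ∷ r-prime ∷ rs-prime) _ small′ =
    contradiction small′ (¬three-prime-factors p-prime q-prime r-prime (productOfPrimes≥1 rs-prime))

prime∤⇒coprime : Prime p → ¬ p ∣ d → Coprime d p
prime∤⇒coprime p-prime p∤d (i∣d , i∣p) with prime⇒irreducible p-prime i∣p
... | inj₁ i≡1 = i≡1
... | inj₂ refl = contradiction i∣d p∤d

∣prime⇒∈ : Prime p → d ∣ p → d ∈ 1 ∷ p ∷ []
∣prime⇒∈ p-prime d∣p with prime⇒irreducible p-prime d∣p
... | inj₁ d≡1 = here d≡1
... | inj₂ d≡p = there (here d≡p)

∣prime*prime⇒∈ : Prime p → Prime q → d ∣ p * q → d ∈ 1 ∷ p * q ∷ p ∷ q ∷ []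
∣prime*prime⇒∈ {p} {q} {d} p-prime q-prime d∣pq with p ∣? d
... | yes (divides e refl)
  with prime⇒irreducible q-prime
         (*-cancelˡ-∣ p {{prime⇒nonZero p-prime}} (subst (_∣ p * q) (*-comm e p) d∣pq))
...   | inj₁ refl = there (there (here (*-identityˡ p)))
...   | inj₂ refl = there (here (*-comm q p))
∣prime*prime⇒∈ {p} {q} {d} p-prime q-prime d∣pq | no p∤d
  with prime⇒irreducible q-prime (coprime-divisor (prime∤⇒coprime p-prime p∤d) d∣pq)
...   | inj₁ d≡1 = here d≡1
...   | inj₂ d≡q = there (there (there (here d≡q)))

∣prime²⇒∈ : Prime p → d ∣ p * p → d ∈ 1 ∷ p * p ∷ p ∷ []
∣prime²⇒∈ p-prime d∣pp with ∣prime*prime⇒∈ p-prime p-prime d∣pp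
... | here d≡1                         = here d≡1
... | there (here d≡pp)                = there (here d≡pp)
... | there (there (here d≡p))         = there (there (here d≡p))
... | there (there (there (here d≡p))) = there (there (here d≡p))

properDivisors : Shape n → List ℕ
properDivisors (prime _)                 = []
properDivisors (primeSquare {p} _)       = p ∷ []
properDivisors (semiprime {p} {q} _ _ _ _) = p ∷ q ∷ []

∣shape⇒∈ : (sh : Shape n) → d ∣ n → d ∈ 1 ∷ n ∷ properDivisors sh
∣shape⇒∈ (prime p-prime)                   = ∣prime⇒∈ p-prime
∣shape⇒∈ (primeSquare p-prime)             = ∣prime²⇒∈ p-prime
∣shape⇒∈ (semiprime p-prime q-prime _ _)   = ∣prime*prime⇒∈ p-prime q-prime

properDivisorSum : Shape n → ℕ → ℕ
properDivisorSum sh s = sum (map (_^ s) (properDivisors sh))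

cx³+x⁴≤cx⁴ : 2 ≤ c → 2 ≤ x → c * (x * x * x) + x * x * (x * x) ≤ c * (x * x * (x * x))
cx³+x⁴≤cx⁴ {c} {x} 2≤c 2≤x = begin
  c * (x * x * x) + x * x * (x * x) ≡⟨ factor c x ⟩
  x * x * x * (c + x)               ≤⟨ *-monoʳ-≤ (x * x * x) (m+n≤m*n 2≤c 2≤x) ⟩
  x * x * x * (c * x)               ≡⟨ reorder c x ⟩
  c * (x * x * (x * x))             ∎
  where
  open ≤-Reasoning
  factor : ∀ c x → c * (x * x * x) + x * x * (x * x) ≡ x * x * x * (c + x)
  factor = solve-∀
  reorder : ∀ c x → x * x * x * (c * x) ≡ c * (x * x * (x * x))
  reorder = solve-∀

cx³+ey³+x²y²≤[c+e+1]x²y² : x ≤ y * y → y ≤ x * x →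
  c * (x * x * x) + e * (y * y * y) + x * x * (y * y) ≤ (c + e + 1) * (x * x * (y * y))
cx³+ey³+x²y²≤[c+e+1]x²y² {x} {y} {c} {e} x≤y² y≤x² = begin
  c * (x * x * x) + e * (y * y * y) + x * x * (y * y)
    ≤⟨ +-monoˡ-≤ (x * x * (y * y)) (+-mono-≤ (*-monoʳ-≤ c x³≤x²y²) (*-monoʳ-≤ e y³≤x²y²)) ⟩
  c * (x * x * (y * y)) + e * (x * x * (y * y)) + x * x * (y * y)
    ≡⟨ collect c e (x * x * (y * y)) ⟩
  (c + e + 1) * (x * x * (y * y)) ∎
  where
  open ≤-Reasoning
  collect : ∀ c e z → c * z + e * z + z ≡ (c + e + 1) * z
  collect = solve-∀
  x³≤x²y² : x * x * x ≤ x * x * (y * y)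
  x³≤x²y² = *-monoʳ-≤ (x * x) x≤y²
  y³≤x²y² : y * y * y ≤ x * x * (y * y)
  y³≤x²y² = subst (y * y * y ≤_) (*-comm (y * y) (x * x)) (*-monoʳ-≤ (y * y) y≤x²)

-- Writing p² = q + t, the claim becomes p³ + 1 ≤ q² t, and t < p forces q + p > p².
p³+q³+1≤p²q² : p < q → q < p * p → p * p * p + q * q * q + 1 ≤ p * q * (p * q)
p³+q³+1≤p²q² {zero} _ ()
p³+q³+1≤p²q² {p@(suc _)} {q} p<q q<p² with o , q+1+o≡p² ← m≤n⇒∃[o]m+o≡n q<p² = begin
  p * p * p + q * q * q + 1   ≡⟨ +-comm-middle (p * p * p) (q * q * q) ⟩
  q * q * q + (p * p * p + 1) ≤⟨ +-monoʳ-≤ (q * q * q) p³+1≤q²t ⟩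
  q * q * q + q * q * t       ≡⟨ *-distribˡ-+ (q * q) q t ⟨
  q * q * (q + t)             ≡⟨ cong (q * q *_) p²≡q+t ⟨
  q * q * (p * p)             ≡⟨ reorder p q ⟩
  p * q * (p * q)             ∎
  where
  open ≤-Reasoning
  t = suc o
  p²≡q+t : p * p ≡ q + t
  p²≡q+t = trans (sym q+1+o≡p²) (sym (+-suc q o))
  +-comm-middle : ∀ a b → a + b + 1 ≡ b + (a + 1)
  +-comm-middle = solve-∀
  reorder : ∀ p q → q * q * (p * p) ≡ p * q * (p * q)
  reorder = solve-∀
  q≤q*t : q * q ≤ q * q * t
  q≤q*t = m≤m*n (q * q) t
  p³+1≤q²t : p * p * p + 1 ≤ q * q * t
  p³+1≤q²t with p ≤? t
  ... | yes p≤t = begin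
    p * p * p + 1               ≤⟨ +-monoʳ-≤ (p * p * p) (s≤s z≤n) ⟩
    p * p * p + p               ≤⟨ m≤m+n (p * p * p + p) (2 * (p * p)) ⟩
    p * p * p + p + 2 * (p * p) ≡⟨ expand p ⟩
    suc p * suc p * p           ≤⟨ *-mono-≤ (*-mono-≤ p<q p<q) p≤t ⟩
    q * q * t                   ∎
    where
    expand : ∀ p → p * p * p + p + 2 * (p * p) ≡ (1 + p) * (1 + p) * p
    expand = solve-∀
  ... | no p≰t = begin
    p * p * p + 1 ≤⟨ +-cancelʳ-≤ (p * suc p) _ _ (begin
      p * p * p + 1 + p * suc p ≡⟨ expand₁ p ⟩
      suc p * suc (p * p)       ≤⟨ *-monoʳ-≤ (suc p) p²<q+p ⟩
      suc p * (q + p)           ≡⟨ expand₂ p q ⟩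
      suc p * q + p * suc p     ∎) ⟩
    suc p * q     ≤⟨ *-monoˡ-≤ q p<q ⟩
    q * q         ≤⟨ q≤q*t ⟩
    q * q * t     ∎
    where
    p²<q+p : p * p < q + p
    p²<q+p = subst (_< q + p) (sym p²≡q+t) (+-monoʳ-< q (≰⇒> p≰t))
    expand₁ : ∀ p → p * p * p + 1 + p * (1 + p) ≡ (1 + p) * (1 + p * p)
    expand₁ = solve-∀
    expand₂ : ∀ p q → (1 + p) * (q + p) ≡ (1 + p) * q + p * (1 + p)
    expand₂ = solve-∀

prime²-properDivisors-bound : ∀ k → 2 ≤ p → 1 ≤ k →
  p * p * (p * p) * (p ^ (3 * k) + 0) + (p * p) ^ k * (p * p) ^ k ≤ p * p * (p * p) * ((p * p) ^ k * (p * p) ^ k)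
prime²-properDivisors-bound {p} k 2≤p 1≤k
  rewrite ^-cube p k | ^-distribʳ-* p p k | +-identityʳ (p ^ k * p ^ k * p ^ k) =
  cx³+x⁴≤cx⁴ (≤-trans 2≤p p≤p⁴) (≤-trans 2≤p (m≤m^n p 1≤k))
  where
  instance _ = >-nonZero (≤-trans (s≤s z≤n) 2≤p)
  p≤p⁴ : p ≤ p * p * (p * p)
  p≤p⁴ = ≤-trans (m≤m*n p p) (m≤m*n (p * p) (p * p) {{m*n≢0 p p}})

semiprime-properDivisors-bound : ∀ j → p < q → q < p * p →
  p * q * (p * q) * (p ^ (3 * suc j) + (q ^ (3 * suc j) + 0)) + (p * q) ^ suc j * (p * q) ^ suc j
    ≤ p * q * (p * q) * ((p * q) ^ suc j * (p * q) ^ suc j)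
semiprime-properDivisors-bound {p} {q} j p<q q<p²
  rewrite ^-cube p (suc j) | ^-cube q (suc j) | ^-distribʳ-* p q (suc j)
        | +-identityʳ (q ^ suc j * q ^ suc j * q ^ suc j) = begin
  pq² * ((p * pʲ) * (p * pʲ) * (p * pʲ) + (q * qʲ) * (q * qʲ) * (q * qʲ)) + (p * pʲ * (q * qʲ)) * (p * pʲ * (q * qʲ))
    ≡⟨ factor p q pʲ qʲ ⟩
  pq² * (p * p * p * (pʲ * pʲ * pʲ) + q * q * q * (qʲ * qʲ * qʲ) + pʲ * pʲ * (qʲ * qʲ))
    ≤⟨ *-monoʳ-≤ pq² (cx³+ey³+x²y²≤[c+e+1]x²y² {c = p * p * p} {e = q * q * q} pʲ≤qʲ² qʲ≤pʲ²) ⟩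
  pq² * ((p * p * p + q * q * q + 1) * (pʲ * pʲ * (qʲ * qʲ)))
    ≤⟨ *-monoʳ-≤ pq² (*-monoˡ-≤ (pʲ * pʲ * (qʲ * qʲ)) (p³+q³+1≤p²q² p<q q<p²)) ⟩
  pq² * (pq² * (pʲ * pʲ * (qʲ * qʲ)))
    ≡⟨ regroup p q pʲ qʲ ⟩
  pq² * ((p * pʲ * (q * qʲ)) * (p * pʲ * (q * qʲ))) ∎
  where
  open ≤-Reasoning
  pq² = p * q * (p * q)
  pʲ = p ^ j
  qʲ = q ^ j
  instance _ = >-nonZero (≤-<-trans z≤n p<q)
  pʲ≤qʲ² : pʲ ≤ qʲ * qʲ
  pʲ≤qʲ² = ≤-trans (^-monoˡ-≤ j (<⇒≤ p<q)) (m≤m*n qʲ qʲ {{m^n≢0 q j}})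
  qʲ≤pʲ² : qʲ ≤ pʲ * pʲ
  qʲ≤pʲ² = ≤-trans (^-monoˡ-≤ j (<⇒≤ q<p²)) (≤-reflexive (^-distribʳ-* p p j))
  factor : ∀ p q x y →
    p * q * (p * q) * ((p * x) * (p * x) * (p * x) + (q * y) * (q * y) * (q * y)) + (p * x * (q * y)) * (p * x * (q * y))
      ≡ p * q * (p * q) * (p * p * p * (x * x * x) + q * q * q * (y * y * y) + x * x * (y * y))
  factor = solve-∀
  regroup : ∀ p q x y → p * q * (p * q) * (p * q * (p * q) * (x * x * (y * y)))
                        ≡ p * q * (p * q) * ((p * x * (q * y)) * (p * x * (q * y)))
  regroup = solve-∀

properDivisors-bound : (sh : Shape n) → 1 ≤ k →
  n * n * properDivisorSum sh (3 * k) + n ^ k * n ^ k ≤ n * n * (n ^ k * n ^ k)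
properDivisors-bound {n = p} {k} (prime p-prime) _ = begin
  p * p * 0 + p ^ k * p ^ k ≡⟨ cong (_+ p ^ k * p ^ k) (*-zeroʳ (p * p)) ⟩
  p ^ k * p ^ k             ≤⟨ m≤n*m (p ^ k * p ^ k) (p * p) ⟩
  p * p * (p ^ k * p ^ k)   ∎
  where
  open ≤-Reasoning
  instance
    _ = prime⇒nonZero p-prime
    _ = m*n≢0 p p
properDivisors-bound {k = k} (primeSquare p-prime) 1≤k =
  prime²-properDivisors-bound k (prime⇒2≤ p-prime) 1≤k
properDivisors-bound {k = suc j} (semiprime _ _ p<q q<p²) _ =
  semiprime-properDivisors-bound j p<q q<p²

geometric₃ : ℕ → ℕ
geometric₃ x = x * x * x + x * x + x + 1

geometric₃-^ : ∀ n k → n ^ (3 * k) + n ^ (2 * k) + n ^ k + 1 ≡ geometric₃ (n ^ k)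
geometric₃-^ n k = cong₂ (λ u v → u + v + n ^ k + 1) (^-cube n k) (^-square n k)

m²+m+1≤4m² : 1 ≤ m → m * m + m + 1 ≤ 4 * (m * m)
m²+m+1≤4m² {m} 1≤m = begin
  m * m + m + 1                   ≤⟨ +-mono-≤ (+-monoʳ-≤ (m * m) m≤m²) 1≤m² ⟩
  m * m + m * m + m * m           ≤⟨ m≤n+m (m * m + m * m + m * m) (m * m) ⟩
  m * m + (m * m + m * m + m * m) ≡⟨ four-times (m * m) ⟩
  4 * (m * m)                     ∎
  where
  open ≤-Reasoning
  instance _ = >-nonZero 1≤m
  m≤m² = m≤m*n m m
  1≤m² = *-mono-≤ 1≤m 1≤m
  four-times : ∀ z → z + (z + z + z) ≡ 4 * z
  four-times = solve-∀

-- E = m + m² − S is what the proper divisors leave of the middle terms m² + m of geometric₃ m.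
slack : 4 ≤ c → 1 ≤ m → c * S + m * m ≤ c * (m * m) →
        ∃[ E ] 1 + m * m * m + S + E ≡ geometric₃ m × geometric₃ m ≤ c * m * E
slack {c} {m} {S} 4≤c 1≤m bound = E , total , geometric₃≤
  where
  open ≤-Reasoning
  instance _ = >-nonZero (≤-trans (s≤s z≤n) 4≤c)
  S≤m² : S ≤ m * m
  S≤m² = *-cancelˡ-≤ c (≤-trans (m≤m+n (c * S) (m * m)) bound)
  E = m + m * m ∸ S
  S+E≡m+m² : S + E ≡ m + m * m
  S+E≡m+m² = m+[n∸m]≡n (≤-trans S≤m² (m≤n+m (m * m) m))
  total : 1 + m * m * m + S + E ≡ geometric₃ m
  total = begin-equality
    1 + m * m * m + S + E       ≡⟨ +-assoc (1 + m * m * m) S E ⟩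
    1 + m * m * m + (S + E)     ≡⟨ cong (λ t → 1 + m * m * m + t) S+E≡m+m² ⟩
    1 + m * m * m + (m + m * m) ≡⟨ rearrange m ⟩
    geometric₃ m                ∎
    where
    rearrange : ∀ m → 1 + m * m * m + (m + m * m) ≡ m * m * m + m * m + m + 1
    rearrange = solve-∀
  m²+cm≤cE : m * m + c * m ≤ c * E
  m²+cm≤cE = +-cancelʳ-≤ (c * S) _ _ (begin
    m * m + c * m + c * S   ≡⟨ rearrange (m * m) (c * m) (c * S) ⟩
    c * m + (c * S + m * m) ≤⟨ +-monoʳ-≤ (c * m) bound ⟩
    c * m + c * (m * m)     ≡⟨ *-distribˡ-+ c m (m * m) ⟨
    c * (m + m * m)         ≡⟨ cong (c *_) S+E≡m+m² ⟨
    c * (S + E)             ≡⟨ *-distribˡ-+ c S E ⟩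
    c * S + c * E           ≡⟨ +-comm (c * S) (c * E) ⟩
    c * E + c * S           ∎)
    where
    rearrange : ∀ a b d → a + b + d ≡ b + (d + a)
    rearrange = solve-∀
  geometric₃≤ : geometric₃ m ≤ c * m * E
  geometric₃≤ = begin
    geometric₃ m                  ≡⟨ regroup m ⟩
    m * m * m + (m * m + m + 1)   ≤⟨ +-monoʳ-≤ (m * m * m) (m²+m+1≤4m² 1≤m) ⟩
    m * m * m + 4 * (m * m)       ≤⟨ +-monoʳ-≤ (m * m * m) (*-monoˡ-≤ (m * m) 4≤c) ⟩
    m * m * m + c * (m * m)       ≡⟨ factor m c ⟩
    m * (m * m + c * m)           ≤⟨ *-monoʳ-≤ m m²+cm≤cE ⟩
    m * (c * E)                   ≡⟨ reorder m c E ⟩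
    c * m * E                     ∎
    where
    regroup : ∀ m → m * m * m + m * m + m + 1 ≡ m * m * m + (m * m + m + 1)
    regroup = solve-∀
    factor : ∀ m c → m * m * m + c * (m * m) ≡ m * (m * m + c * m)
    factor = solve-∀
    reorder : ∀ m c E → m * (c * E) ≡ c * m * E
    reorder = solve-∀

σ-slack : 2 ≤ n → Shape n → 1 ≤ k →
          ∃[ E ] σ (3 * k) n + E ≤ geometric₃ (n ^ k) × geometric₃ (n ^ k) ≤ n * n * n ^ k * E
σ-slack {n} {k} 2≤n sh 1≤k
  with E , total , geometric₃≤ ←
         slack (*-mono-≤ 2≤n 2≤n) (m^n>0 n {{>-nonZero (≤-trans (s≤s z≤n) 2≤n)}} k)
               (properDivisors-bound sh 1≤k) =
  E , ≤-trans (+-monoˡ-≤ E σ-bound) (≤-reflexive total) , geometric₃≤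
  where
  σ-bound : σ (3 * k) n ≤ 1 + n ^ k * n ^ k * n ^ k + properDivisorSum sh (3 * k)
  σ-bound = subst (λ t → σ (3 * k) n ≤ 1 + t + properDivisorSum sh (3 * k)) (^-cube n k)
                  (σ-upper (3 * k) (properDivisors sh) (∣shape⇒∈ sh))

-- In geometric₃ M = (1 + M³) + (M + M²) the second part is absorbed:
-- (M + M²) · geometric₃ m ≤ (M² + M³) · E < geometric₃ M · E.
geometric₃-cross : ∀ E → σ₁ + E ≤ geometric₃ m → geometric₃ m ≤ M * E → 1 + M * M * M ≤ σ₂ →
                   geometric₃ M * σ₁ < geometric₃ m * σ₂
geometric₃-cross {σ₁} {m} {M} {σ₂} E σ₁+E≤ geometric₃≤ σ₂-lower = begin-strict
  geometric₃ M * σ₁              <⟨ +-cancelʳ-< (geometric₃ M * E) _ _ shifted ⟩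
  (1 + M * M * M) * geometric₃ m ≤⟨ *-monoˡ-≤ (geometric₃ m) σ₂-lower ⟩
  σ₂ * geometric₃ m              ≡⟨ *-comm σ₂ (geometric₃ m) ⟩
  geometric₃ m * σ₂              ∎
  where
  open ≤-Reasoning
  instance _ = m*n≢0⇒n≢0 M {{>-nonZero (≤-trans (m≤n+m 1 _) geometric₃≤)}}
  shifted : geometric₃ M * σ₁ + geometric₃ M * E < (1 + M * M * M) * geometric₃ m + geometric₃ M * E
  shifted = begin-strict
    geometric₃ M * σ₁ + geometric₃ M * E            ≡⟨ *-distribˡ-+ (geometric₃ M) σ₁ E ⟨
    geometric₃ M * (σ₁ + E)                         ≤⟨ *-monoʳ-≤ (geometric₃ M) σ₁+E≤ ⟩
    geometric₃ M * geometric₃ m                     ≡⟨ split M (geometric₃ m) ⟩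
    (1 + M * M * M) * geometric₃ m + (M + M * M) * geometric₃ m
      ≤⟨ +-monoʳ-≤ ((1 + M * M * M) * geometric₃ m) (*-monoʳ-≤ (M + M * M) geometric₃≤) ⟩
    (1 + M * M * M) * geometric₃ m + (M + M * M) * (M * E)
      ≡⟨ cong (λ t → (1 + M * M * M) * geometric₃ m + t) (raise M E) ⟩
    (1 + M * M * M) * geometric₃ m + (M * M + M * M * M) * E
      <⟨ +-monoʳ-< ((1 + M * M * M) * geometric₃ m) (m<m+n ((M * M + M * M * M) * E) 0<[1+M]E) ⟩
    (1 + M * M * M) * geometric₃ m + ((M * M + M * M * M) * E + (1 + M) * E)
      ≡⟨ cong (λ t → (1 + M * M * M) * geometric₃ m + t) (collect M E) ⟩
    (1 + M * M * M) * geometric₃ m + geometric₃ M * E ∎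
    where
    0<[1+M]E : 0 < (1 + M) * E
    0<[1+M]E = >-nonZero⁻¹ ((1 + M) * E) {{m*n≢0 (1 + M) E}}
    split : ∀ M g → (M * M * M + M * M + M + 1) * g ≡ (1 + M * M * M) * g + (M + M * M) * g
    split = solve-∀
    raise : ∀ M E → (M + M * M) * (M * E) ≡ (M * M + M * M * M) * E
    raise = solve-∀
    collect : ∀ M E → (M * M + M * M * M) * E + (1 + M) * E ≡ (M * M * M + M * M + M + 1) * E
    collect = solve-∀

even⊎odd : ∀ n → 2 ∣ n ⊎ 2 ∣ suc n
even⊎odd zero = inj₁ (divides 0 refl)
even⊎odd (suc n) with even⊎odd n
... | inj₁ (divides q refl) = inj₂ (divides (suc q) refl)
... | inj₂ 2∣1+n            = inj₁ 2∣1+n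

odd<odd⇒2+≤ : ∀ {k l} → ¬ 2 ∣ k → ¬ 2 ∣ l → k < l → 2 + k ≤ l
odd<odd⇒2+≤ {k} k-odd l-odd k<l =
  ≤∧≢⇒< k<l (λ 1+k≡l → [ k-odd , l-odd ∘ subst (2 ∣_) 1+k≡l ]′ (even⊎odd k))

m<n⇒m-n<0 : m < n → + m ℤ.- + n <ℤ 0ℤ
m<n⇒m-n<0 {m} {n} m<n = subst₂ _<ℤ_ (sym (m-n≡m⊖n m n)) (n⊖n≡0 n) (⊖-monoˡ-< n m<n)

a≡difference : ∀ k ℓ n → a k ℓ n ≡ + (geometric₃ (n ^ ℓ) * σ (3 * k) n) ℤ.- + (geometric₃ (n ^ k) * σ (3 * ℓ) n)
a≡difference k ℓ n = cong₂ ℤ._-_ (term ℓ k) (term k ℓ)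
  where
  term : ∀ i j → + (n ^ (3 * i) + n ^ (2 * i) + n ^ i + 1) ℤ.* + σ (3 * j) n
                 ≡ + (geometric₃ (n ^ i) * σ (3 * j) n)
  term i j = trans (cong (λ t → + t ℤ.* + σ (3 * j) n) (geometric₃-^ n i))
                   (sym (pos-* (geometric₃ (n ^ i)) (σ (3 * j) n)))

lemma3p6 : (k ℓ n : ℕ) → 0 < k → ¬ (2 ∣ k) → ¬ (2 ∣ ℓ) → k < ℓ → 2 ≤ n
           → ((p : ℕ) → Prime p → p ∣ n → n < p ^ 3)
           → a k ℓ n <ℤ 0ℤ
lemma3p6 k ℓ n 0<k k-odd ℓ-odd k<ℓ 2≤n small
  with E , σ+E≤ , geometric₃≤n²nᵏE ← σ-slack 2≤n (shape 2≤n small) 0<k =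
  subst (_<ℤ 0ℤ) (sym (a≡difference k ℓ n))
    (m<n⇒m-n<0 (geometric₃-cross {m = n ^ k} {M = n ^ ℓ} E σ+E≤
                  (≤-trans geometric₃≤n²nᵏE (*-monoˡ-≤ E n²·nᵏ≤nˡ)) σ-lower-cube))
  where
  instance _ = >-nonZero (≤-trans (s≤s z≤n) 2≤n)
  n²·nᵏ≤nˡ : n * n * n ^ k ≤ n ^ ℓ
  n²·nᵏ≤nˡ = subst (_≤ n ^ ℓ) (sym (*-assoc n n (n ^ k))) (^-monoʳ-≤ n (odd<odd⇒2+≤ k-odd ℓ-odd k<ℓ))
  σ-lower-cube : 1 + n ^ ℓ * n ^ ℓ * n ^ ℓ ≤ σ (3 * ℓ) n
  σ-lower-cube = subst (λ t → 1 + t ≤ σ (3 * ℓ) n) (^-cube n ℓ) (σ-lower (3 * ℓ) 2≤n)
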